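{- Let $A$ be a finite set. Every relationally defined permutation clone on $A$ is borrow closed.
   Context: $B_n(A)=\mathrm{Sym}(A^n)$, $B(A)=\bigcup_n B_n(A)$; $i_1$ is the identity of $A$; $f\oplus g$ applies $f\in B_n(A)$ to the first $n$ and $g\in B_m(A)$ to the last $m$ coordinates of $A^{n+m}$. For a relation $R\subseteq A^k$, $\mathrm{PPol}(R)$ is the set of $f\in B_n(A)$ ($n\in\mathbb{N}$) such that for every $k\times n$ array with all columns in $R$, applying $f$ to each row yields an array with all columns in $R$ (equivalently, the polymorphisms of the characteristic weight $w_R:A^k\to(\{0,1\},\wedge)$). A relationally defined permutation clone is one of the form $\mathrm{PPol}(R)$ for a relation $R$ on $A$. A set $C\subseteq B(A)$ is borrow closed if $f\oplus i_1\in C$ implies $f\in C$. -}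

module Defs where

open import Data.Nat using (ℕ; zero; suc; _+_)
open import Data.Fin using (Fin)
open import Data.Vec using (Vec; []; _∷_; _++_; take; drop; map; lookup)
open import Data.Vec.Properties using (take++drop≡id)
open import Data.Product using (Σ; ∃; ∃-syntax; _,_; _×_)
open import Function using (_↔_; Inverse; mk↔ₛ′; id)
open import Function.Bundles using (_⇔_)
open import Relation.Binary.PropositionalEquality using (_≡_; refl; cong; cong₂; trans; sym)

Perm : Set → ℕ → Set
Perm A n = Vec A n ↔ Vec A n

app : ∀ {A n} → Perm A n → Vec A n → Vec A n
app f = Inverse.to f

appInv : ∀ {A n} → Perm A n → Vec A n → Vec A n
appInv f = Inverse.from f

i₁ : ∀ {A} → Perm A 1
i₁ = mk↔ₛ′ id id (λ _ → refl) (λ _ → refl)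

private
  take-++ : ∀ {A : Set} m {n} (xs : Vec A m) (ys : Vec A n) → take m (xs ++ ys) ≡ xs
  take-++ zero [] ys = refl
  take-++ (suc m) (x ∷ xs) ys = cong (x ∷_) (take-++ m xs ys)

  drop-++ : ∀ {A : Set} m {n} (xs : Vec A m) (ys : Vec A n) → drop m (xs ++ ys) ≡ ys
  drop-++ zero [] ys = refl
  drop-++ (suc m) (x ∷ xs) ys = drop-++ m xs ys

_⊕_ : ∀ {A n m} → Perm A n → Perm A m → Perm A (n + m)
_⊕_ {A} {n} {m} f g = mk↔ₛ′ to from invˡ invʳ
  where
  to : Vec A (n + m) → Vec A (n + m)
  to v = app f (take n v) ++ app g (drop n v)
  from : Vec A (n + m) → Vec A (n + m)
  from v = appInv f (take n v) ++ appInv g (drop n v)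
  invˡ : ∀ v → to (from v) ≡ v
  invˡ v = trans
    (cong₂ _++_
      (trans (cong (app f) (take-++ n _ _)) (Inverse.strictlyInverseˡ f (take n v)))
      (trans (cong (app g) (drop-++ n _ _)) (Inverse.strictlyInverseˡ g (drop n v))))
    (take++drop≡id n v)
  invʳ : ∀ v → from (to v) ≡ v
  invʳ v = trans
    (cong₂ _++_
      (trans (cong (appInv f) (take-++ n _ _)) (Inverse.strictlyInverseʳ f (take n v)))
      (trans (cong (appInv g) (drop-++ n _ _)) (Inverse.strictlyInverseʳ g (drop n v))))
    (take++drop≡id n v)

Relation : Set → ℕ → Set₁
Relation A k = Vec A k → Set

PermSet : Set → Set₁
PermSet A = ∀ n → Perm A n → Set

column : ∀ {A : Set} {k n : ℕ} → Vec (Vec A n) k → Fin n → Vec A k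
column rows j = map (λ row → lookup row j) rows

PPol : ∀ {A k} → Relation A k → PermSet A
PPol {A} {k} R n f =
  (rows : Vec (Vec A n) k) →
  (∀ j → R (column rows j)) →
  ∀ j → R (column (map (app f) rows) j)

RelationallyDefined : ∀ {A} → PermSet A → Set₁
RelationallyDefined {A} C =
  ∃[ k ] Σ (Relation A k) λ R → ∀ n (f : Perm A n) → C n f ⇔ PPol R n f

BorrowClosed : ∀ {A} → PermSet A → Set
BorrowClosed {A} C = ∀ n (f : Perm A n) → C (n + 1) (f ⊕ i₁) → C n f

{-# OPTIONS --safe #-}
module Submission where

-- If f ⊕ g preserves R, so does f: given an array whose columns lie in R,
-- pad every row with copies of its j-th entry. Each new column is a copy of
-- column j, so the padded array still has its columns in R; applying f ⊕ g to
-- it leaves the first n columns as f alone would compute them, so column j of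
-- the f-image lies in R. Relational definability then transfers this to C.

open import Defs
open import Data.Nat using (ℕ; _+_)
open import Data.Fin using (Fin; splitAt; _↑ˡ_)
open import Data.Product using (_,_)
open import Data.Sum using (inj₁; inj₂; [_,_]′)
open import Data.Vec using (Vec; _++_; take; map; lookup; replicate)
open import Data.Vec.Properties
  using (take++drop≡id; ++-injectiveˡ; lookup-splitAt; lookup-++ˡ; lookup-replicate; map-∘; map-cong)
open import Function using (Equivalence; _⇔_; id; const; _∘_)
open import Relation.Binary.PropositionalEquality using (_≡_; refl; trans; sym; cong; subst; module ≡-Reasoning)

private variable
  A : Set
  k m n : ℕ

take-++ : (xs : Vec A m) (ys : Vec A n) → take m (xs ++ ys) ≡ xs
take-++ {m = m} xs ys = ++-injectiveˡ (take m (xs ++ ys)) xs (take++drop≡id m (xs ++ ys))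

lookup-⊕-↑ˡ : (f : Perm A n) (g : Perm A m) (xs : Vec A n) (ys : Vec A m) (j : Fin n) →
              lookup (app (f ⊕ g) (xs ++ ys)) (j ↑ˡ m) ≡ lookup (app f xs) j
lookup-⊕-↑ˡ {n = n} f g xs ys j =
  trans (lookup-++ˡ (app f (take n (xs ++ ys))) _ j) (cong (λ v → lookup (app f v) j) (take-++ xs ys))

column-map : (g : Vec A n → Vec A m) (rows : Vec (Vec A n) k) (i : Fin m) →
             column (map g rows) i ≡ map (λ row → lookup (g row) i) rows
column-map g rows i = sym (map-∘ (λ row → lookup row i) g rows)

module _ (m : ℕ) (j : Fin n) where

  padWithCopies : Vec A n → Vec A (n + m)
  padWithCopies row = row ++ replicate m (lookup row j)

  copiedColumn : Fin (n + m) → Fin n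
  copiedColumn i = [ id , const j ]′ (splitAt n i)

  lookup-padWithCopies : (row : Vec A n) (i : Fin (n + m)) →
                         lookup (padWithCopies row) i ≡ lookup row (copiedColumn i)
  lookup-padWithCopies row i = trans (lookup-splitAt n row _ i) (lookup-part (splitAt n i))
    where
    lookup-part : ∀ s → [ lookup row , lookup (replicate m (lookup row j)) ]′ s
                        ≡ lookup row ([ id , const j ]′ s)
    lookup-part (inj₁ i) = refl
    lookup-part (inj₂ i) = lookup-replicate i (lookup row j)

  column-padWithCopies : (rows : Vec (Vec A n) k) (i : Fin (n + m)) →
                         column (map padWithCopies rows) i ≡ column rows (copiedColumn i)
  column-padWithCopies rows i =
    trans (column-map padWithCopies rows i) (map-cong (λ row → lookup-padWithCopies row i) rows)

PPol-⊕⁻ˡ : (R : Relation A k) (f : Perm A n) (g : Perm A m) → PPol R (n + m) (f ⊕ g) → PPol R n f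
PPol-⊕⁻ˡ {m = m} R f g f⊕g∈PPol rows columns∈R j =
  subst R image-column (f⊕g∈PPol (map pad rows) padded∈R (j ↑ˡ m))
  where
  pad = padWithCopies m j

  padded∈R : ∀ i → R (column (map pad rows) i)
  padded∈R i = subst R (sym (column-padWithCopies m j rows i)) (columns∈R (copiedColumn m j i))

  open ≡-Reasoning

  image-column : column (map (app (f ⊕ g)) (map pad rows)) (j ↑ˡ m) ≡ column (map (app f) rows) j
  image-column = begin
    column (map (app (f ⊕ g)) (map pad rows)) (j ↑ˡ m)
      ≡⟨ cong (λ array → column array (j ↑ˡ m)) (sym (map-∘ (app (f ⊕ g)) pad rows)) ⟩
    column (map (app (f ⊕ g) ∘ pad) rows) (j ↑ˡ m)
      ≡⟨ column-map (app (f ⊕ g) ∘ pad) rows (j ↑ˡ m) ⟩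
    map (λ row → lookup (app (f ⊕ g) (pad row)) (j ↑ˡ m)) rows
      ≡⟨ map-cong (λ row → lookup-⊕-↑ˡ f g row _ j) rows ⟩
    map (λ row → lookup (app f row) j) rows
      ≡⟨ sym (column-map (app f) rows j) ⟩
    column (map (app f) rows) j ∎

PPol-borrowClosed : (R : Relation A k) → BorrowClosed (PPol R)
PPol-borrowClosed R n f = PPol-⊕⁻ˡ R f i₁

BorrowClosed-resp-⇔ : {C D : PermSet A} → (∀ n f → C n f ⇔ D n f) → BorrowClosed D → BorrowClosed C
BorrowClosed-resp-⇔ C⇔D D-closed n f =
  Equivalence.from (C⇔D n f) ∘ D-closed n f ∘ Equivalence.to (C⇔D (n + 1) (f ⊕ i₁))

lemma5 : (a : ℕ) (C : PermSet (Fin a)) → RelationallyDefined C → BorrowClosed C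
lemma5 a C (k , R , C⇔PPol) = BorrowClosed-resp-⇔ C⇔PPol (PPol-borrowClosed R)
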